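{- Let $k_i,\ell_i$ ($1\leq i\leq m$), $b$, $n_1$, $n_2$ be positive integers with $k_i,\ell_i\leq b$ for all $i$, $4b<n_1$ and $4b<n_2$. For each $i$ let $\mathcal{R}_i$ be a family of $k_i\times\ell_i$ rectangles in $\mathbb{Z}_{n_1}\times\mathbb{Z}_{n_2}$, and suppose $\mathcal{R}=\bigcup_{i=1}^m\mathcal{R}_i$ is proj-intersecting. Assume that $\mathcal{R}_1$ contains a $b$-blocking pair with base in $\mathbb{Z}_{n_2}$, i.e. two rectangles $I_1\times J_0$, $I_2\times J_0$ with $d(I_1,I_2)\geq b+1$. Then for every $i$ ($1\leq i\leq m$) at least one of $$|\mathcal{R}_i|<9b^2,\qquad |\mathcal{R}_i|\leq 4b^2+(\ell_i-1)n_1,\qquad |\mathcal{R}_i|\leq \ell_i n_1$$ holds.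
   Context: For $u,v\in\mathbb{Z}_n$ the distance $d(u,v)$ is the smaller of $(u-v)\bmod n$ and $(v-u)\bmod n$. An interval of length $a$ in $\mathbb{Z}_n$ is a set $\{i+1,\ldots,i+a\}$ (mod $n$); the distance of two intervals is the minimum distance between an element of one and an element of the other. A $k\times\ell$ rectangle is $I\times J$ with $I$ an interval of length $k$ in $\mathbb{Z}_{n_1}$ and $J$ an interval of length $\ell$ in $\mathbb{Z}_{n_2}$. Rectangles $I\times J$, $I'\times J'$ are proj-intersecting if $I\cap I'\neq\emptyset$ or $J\cap J'\neq\emptyset$; a family is proj-intersecting if every two members are. -}

module Defs where

open import Data.Nat using (ℕ; zero; suc; _+_; _*_; _∸_; _≤_; _<_; _⊓_)
open import Data.Nat.DivMod using (_%_)
open import Data.Fin using (Fin; toℕ)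
open import Data.Product using (_×_; _,_; proj₁; proj₂; ∃; Σ-syntax)
open import Data.Sum using (_⊎_)
open import Data.List using (List; length)
open import Data.List.Membership.Propositional using (_∈_)
open import Relation.Binary.PropositionalEquality using (_≡_)
open import Function.Bundles using (_⇔_)

-- reduction of a natural number modulo n (identity for n = 0, which never
-- occurs since Fin 0 is empty)
modN : ℕ → ℕ → ℕ
modN zero    x = x
modN (suc n) x = x % suc n

dist : (n : ℕ) → Fin n → Fin n → ℕ
dist n u v = modN n (toℕ u + n ∸ toℕ v) ⊓ modN n (toℕ v + n ∸ toℕ u)

InInterval : (n : ℕ) → (s : Fin n) → (a : ℕ) → Fin n → Set
InInterval n s a x = ∃ λ t → (1 ≤ t × t ≤ a) × (toℕ x ≡ modN n (toℕ s + t))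

IntervalsMeet : (n : ℕ) → Fin n → ℕ → Fin n → ℕ → Set
IntervalsMeet n s a s' a' = ∃ λ x → InInterval n s a x × InInterval n s' a' x

SameInterval : (n : ℕ) → Fin n → ℕ → Fin n → ℕ → Set
SameInterval n s a s' a' = ∀ x → InInterval n s a x ⇔ InInterval n s' a' x

IntervalDist≥ : (n : ℕ) → Fin n → ℕ → Fin n → ℕ → ℕ → Set
IntervalDist≥ n s a s' a' d =
  ∀ x y → InInterval n s a x → InInterval n s' a' y → d ≤ dist n x y

-- a rectangle I × J in ℤ_{n₁} × ℤ_{n₂}: I = interval starting after s₁ of
-- length len₁, J = interval starting after s₂ of length len₂
record Rect (n₁ n₂ : ℕ) : Set where
  constructor rect
  field
    s₁   : Fin n₁
    len₁ : ℕ
    s₂   : Fin n₂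
    len₂ : ℕ
open Rect public

ProjIntersecting : {n₁ n₂ : ℕ} → Rect n₁ n₂ → Rect n₁ n₂ → Set
ProjIntersecting {n₁} {n₂} R R' =
  IntervalsMeet n₁ (s₁ R) (len₁ R) (s₁ R') (len₁ R')
  ⊎ IntervalsMeet n₂ (s₂ R) (len₂ R) (s₂ R') (len₂ R')

IsFamily : {n₁ n₂ : ℕ} → ℕ → ℕ → List (Rect n₁ n₂) → Set
IsFamily k ℓ F = (∀ R → R ∈ F → len₁ R ≡ k × len₂ R ≡ ℓ)

UnionProjIntersecting : {n₁ n₂ m : ℕ} → (Fin m → List (Rect n₁ n₂)) → Set
UnionProjIntersecting 𝓡 =
  ∀ i j R R' → R ∈ 𝓡 i → R' ∈ 𝓡 j → ProjIntersecting R R'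

HasBlockingPair : {n₁ n₂ : ℕ} → ℕ → List (Rect n₁ n₂) → Set
HasBlockingPair {n₁} {n₂} b F =
  Σ[ R ∈ Rect n₁ n₂ ] Σ[ R' ∈ Rect n₁ n₂ ]
    R ∈ F × R' ∈ F
    × SameInterval n₂ (s₂ R) (len₂ R) (s₂ R') (len₂ R')
    × IntervalDist≥ n₁ (s₁ R) (len₁ R) (s₁ R') (len₁ R') (suc b)

-- Every rectangle of 𝓡ᵢ has its second interval J meeting the base J₀ of the blocking pair:
-- otherwise its first interval, of length ≤ b, meets both I₁ and I₂, which are more than b apart.
-- So, measured from J₀, the intervals J start at one of P = ℓᵢ + ℓ₀ − 1 ≤ 2b positions pos R,
-- and a rectangle of 𝓡ᵢ is determined by its position and the start of its first interval.
-- If no position is ℓᵢ above the least one, all positions lie in a window of width ℓᵢ and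
-- |𝓡ᵢ| ≤ ℓᵢ n₁. Otherwise pick Q, Q' with pos Q + ℓᵢ ≤ pos Q'. A rectangle whose position is ℓᵢ
-- below pos Q' or ℓᵢ above pos Q has its J disjoint from the J of that anchor, so its first
-- interval meets the anchor's and starts at one of K = 2kᵢ − 1 ≤ 2b offsets from it: there are
-- at most PK ≤ 4b² such rectangles. The remaining ones have positions strictly between pos Q and
-- pos Q + ℓᵢ, hence number at most (ℓᵢ − 1) n₁.

module Submission where

open import Defs
open import Data.Fin using (Fin; zero; suc; toℕ; fromℕ<; combine)
open import Data.Fin.Properties
  using (toℕ<n; toℕ-injective; fromℕ<-injective; combine-injective; pigeonhole)
import Data.Fin.Properties as Fin
open import Data.List using (List; []; _∷_; length; lookup; filter)
open import Data.List.Extrema.Nat using (argmin; argmin-all; f[argmin]≤f[⊤]; f[argmin]≤f[xs])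
open import Data.List.Membership.Propositional using (_∈_; find; lose)
open import Data.List.Membership.Propositional.Properties using (∈-lookup; ∈-filter⁻)
open import Data.List.Relation.Unary.All as All using ()
open import Data.List.Relation.Unary.AllPairs using (_∷_)
open import Data.List.Relation.Unary.Any using (here; there; any?)
open import Data.List.Relation.Unary.Unique.Propositional using (Unique)
open import Data.List.Relation.Unary.Unique.Propositional.Properties using (filter⁺)
open import Data.Nat using (ℕ; zero; suc; _+_; _*_; _∸_; _≤_; _<_; z≤n; s≤s; _≤?_)
open import Data.Nat.DivMod
  using (_%_; %-distribˡ-+; m%n%n≡m%n; [m+n]%n≡m%n; m%n<n; m%n≤n; m<n⇒m%n≡m)
open import Data.Nat.Properties
open import Data.Nat.Tactic.RingSolver using (solve-∀)
open import Algebra.Properties.CommutativeSemigroup +-commutativeSemigroup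
  using (xy∙z≈xz∙y; x∙yz≈y∙xz)
open import Data.Product using (_×_; _,_; proj₁; proj₂; ∃-syntax; map₂; swap)
open import Data.Sum using (_⊎_; inj₁; inj₂; [_,_]; map₁)
open import Function using (_∘_; id)
open import Function.Bundles using (Equivalence)
open import Level using (0ℓ)
open import Relation.Binary.Bundles using (Setoid)
import Relation.Binary.Reasoning.Setoid as SetoidReasoning
open import Relation.Binary.PropositionalEquality
  using (_≡_; refl; sym; trans; cong; cong₂; subst; subst₂; module ≡-Reasoning)
open import Relation.Nullary using (yes; no; contradiction)
open import Relation.Nullary.Decidable using (_⊎-dec_)
open import Relation.Unary using (Pred; Decidable)
open import Relation.Unary.Properties using (∁?)

module Cyclic (n : ℕ) where

  N : ℕ
  N = suc n

  -- A record rather than  x % N ≡ y % N,  so that x and y can be inferred from a proof.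
  infix 4 _≡ₘ_
  record _≡ₘ_ (x y : ℕ) : Set where
    constructor mk≡ₘ
    field residues-eq : x % N ≡ y % N
  open _≡ₘ_

  ≡ₘ-setoid : Setoid 0ℓ 0ℓ
  ≡ₘ-setoid = record
    { _≈_           = _≡ₘ_
    ; isEquivalence = record
      { refl  = mk≡ₘ refl
      ; sym   = λ x≡ₘy → mk≡ₘ (sym (residues-eq x≡ₘy))
      ; trans = λ x≡ₘy y≡ₘz → mk≡ₘ (trans (residues-eq x≡ₘy) (residues-eq y≡ₘz))
      }
    }

  open Setoid ≡ₘ-setoid using () renaming (refl to ≡ₘ-refl; sym to ≡ₘ-sym; trans to ≡ₘ-trans)
  module ≡ₘ-Reasoning = SetoidReasoning ≡ₘ-setoid

  %-≡ₘ : ∀ x → x % N ≡ₘ x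
  %-≡ₘ x = mk≡ₘ (m%n%n≡m%n x N)

  +N-≡ₘ : ∀ x → x + N ≡ₘ x
  +N-≡ₘ x = mk≡ₘ ([m+n]%n≡m%n x N)

  +-congₘ : ∀ {x x' y y'} → x ≡ₘ x' → y ≡ₘ y' → x + y ≡ₘ x' + y'
  +-congₘ {x} {x'} {y} {y'} (mk≡ₘ p) (mk≡ₘ q) = mk≡ₘ (begin
    (x + y) % N            ≡⟨ %-distribˡ-+ x y N ⟩
    (x % N + y % N) % N    ≡⟨ cong₂ (λ u v → (u + v) % N) p q ⟩
    (x' % N + y' % N) % N  ≡⟨ %-distribˡ-+ x' y' N ⟨
    (x' + y') % N          ∎)
    where open ≡-Reasoning

  +-cancelʳ-≡ₘ : ∀ {x y} z → x + z ≡ₘ y + z → x ≡ₘ y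
  +-cancelʳ-≡ₘ {x} {y} z x+z≡ₘy+z = begin
    x            ≡⟨ +-identityʳ x ⟨
    x + 0        ≈⟨ +-congₘ ≡ₘ-refl z+w≡ₘ0 ⟨
    x + (z + w)  ≡⟨ +-assoc x z w ⟨
    x + z + w    ≈⟨ +-congₘ x+z≡ₘy+z ≡ₘ-refl ⟩
    y + z + w    ≡⟨ +-assoc y z w ⟩
    y + (z + w)  ≈⟨ +-congₘ ≡ₘ-refl z+w≡ₘ0 ⟩
    y + 0        ≡⟨ +-identityʳ y ⟩
    y            ∎
    where
    open ≡ₘ-Reasoning
    w = N ∸ z % N
    z+w≡ₘ0 : z + w ≡ₘ 0
    z+w≡ₘ0 = begin
      z + w      ≈⟨ +-congₘ (%-≡ₘ z) ≡ₘ-refl ⟨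
      z % N + w  ≡⟨ m+[n∸m]≡n (m%n≤n z N) ⟩
      N          ≈⟨ +N-≡ₘ 0 ⟩
      0          ∎

  ≡ₘ⇒≡ : ∀ {x y} → x < N → y < N → x ≡ₘ y → x ≡ y
  ≡ₘ⇒≡ x<N y<N (mk≡ₘ e) = trans (sym (m<n⇒m%n≡m x<N)) (trans e (m<n⇒m%n≡m y<N))

  offset : Fin N → ℕ → Fin N → ℕ
  offset r c s = (toℕ s + (N ∸ toℕ r + c)) % N

  offset<N : ∀ r c s → offset r c s < N
  offset<N r c s = m%n<n (toℕ s + (N ∸ toℕ r + c)) N

  offset-≡ₘ : ∀ r c s → offset r c s ≡ₘ toℕ s + (N ∸ toℕ r + c)
  offset-≡ₘ r c s = %-≡ₘ (toℕ s + (N ∸ toℕ r + c))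

  offset-self : ∀ r c → offset r c r ≡ₘ c
  offset-self r c = begin
    offset r c r             ≈⟨ offset-≡ₘ r c r ⟩
    toℕ r + (N ∸ toℕ r + c)  ≡⟨ +-assoc (toℕ r) _ c ⟨
    toℕ r + (N ∸ toℕ r) + c  ≡⟨ cong (_+ c) (m+[n∸m]≡n (<⇒≤ (toℕ<n r))) ⟩
    N + c                    ≡⟨ +-comm N c ⟩
    c + N                    ≈⟨ +N-≡ₘ c ⟩
    c                        ∎
    where open ≡ₘ-Reasoning

  offset-point : ∀ r c s t {x} → toℕ x ≡ (toℕ s + t) % N → offset r c x ≡ₘ offset r c s + t
  offset-point r c s t {x} x≡s+t = begin
    offset r c x         ≈⟨ offset-≡ₘ r c x ⟩
    toℕ x + d            ≡⟨ cong (_+ d) x≡s+t ⟩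
    (toℕ s + t) % N + d  ≈⟨ +-congₘ (%-≡ₘ (toℕ s + t)) ≡ₘ-refl ⟩
    toℕ s + t + d        ≡⟨ xy∙z≈xz∙y (toℕ s) t d ⟩
    toℕ s + d + t        ≈⟨ +-congₘ (offset-≡ₘ r c s) ≡ₘ-refl ⟨
    offset r c s + t     ∎
    where
    open ≡ₘ-Reasoning
    d = N ∸ toℕ r + c

  offset-injective : ∀ r c {s s'} → offset r c s ≡ offset r c s' → s ≡ s'
  offset-injective r c {s} {s'} eq =
    toℕ-injective (≡ₘ⇒≡ (toℕ<n s) (toℕ<n s') (+-cancelʳ-≡ₘ d (begin
      toℕ s + d      ≈⟨ offset-≡ₘ r c s ⟨
      offset r c s   ≡⟨ eq ⟩
      offset r c s'  ≈⟨ offset-≡ₘ r c s' ⟩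
      toℕ s' + d     ∎)))
    where
    open ≡ₘ-Reasoning
    d = N ∸ toℕ r + c

  meet⇒offset< : ∀ r s {a a'} → IntervalsMeet N r a s a' →
                 (a' ∸ 1) + a < N → offset r (a' ∸ 1) s < (a' ∸ 1) + a
  meet⇒offset< r s {a} {a'}
               (x , (t , (1≤t , t≤a) , x∈r) , (t' , (1≤t' , t'≤a') , x∈s)) c+a<N =
    subst (_< c + a) (sym offset≡v) v<c+a
    where
    c = a' ∸ 1
    t'≤c+t : t' ≤ c + t
    t'≤c+t = begin
      t'     ≤⟨ t'≤a' ⟩
      a'     ≡⟨ m+[n∸m]≡n (≤-trans 1≤t' t'≤a') ⟨
      1 + c  ≤⟨ +-monoˡ-≤ c 1≤t ⟩
      t + c  ≡⟨ +-comm t c ⟩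
      c + t  ∎
      where open ≤-Reasoning
    v = c + t ∸ t'
    v+t'≡c+t : v + t' ≡ c + t
    v+t'≡c+t = m∸n+n≡m t'≤c+t
    v<c+a : v < c + a
    v<c+a = begin-strict
      v       <⟨ m<m+n v 1≤t' ⟩
      v + t'  ≡⟨ v+t'≡c+t ⟩
      c + t   ≤⟨ +-monoʳ-≤ c t≤a ⟩
      c + a   ∎
      where open ≤-Reasoning
    offset+t'≡ₘv+t' : offset r c s + t' ≡ₘ v + t'
    offset+t'≡ₘv+t' = begin
      offset r c s + t'  ≈⟨ offset-point r c s t' x∈s ⟨
      offset r c x       ≈⟨ offset-point r c r t x∈r ⟩
      offset r c r + t   ≈⟨ +-congₘ (offset-self r c) ≡ₘ-refl ⟩
      c + t              ≡⟨ v+t'≡c+t ⟨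
      v + t'             ∎
      where open ≡ₘ-Reasoning
    offset≡v : offset r c s ≡ v
    offset≡v = ≡ₘ⇒≡ (offset<N r c s) (<-trans v<c+a c+a<N) (+-cancelʳ-≡ₘ t' offset+t'≡ₘv+t')

  meet⇒offset<offset+ : ∀ r c s s' {a a'} → IntervalsMeet N s a s' a' →
                        offset r c s + a < N → offset r c s' + a' < N →
                        offset r c s' < offset r c s + a
  meet⇒offset<offset+ r c s s' {a} {a'}
                      (x , (t , (_ , t≤a) , x∈s) , (t' , (1≤t' , t'≤a') , x∈s')) o+a<N o'+a'<N =
    begin-strict
      offset r c s'       <⟨ m<m+n _ 1≤t' ⟩
      offset r c s' + t'  ≡⟨ offsets-agree ⟨
      offset r c s + t    ≤⟨ +-monoʳ-≤ _ t≤a ⟩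
      offset r c s + a    ∎
    where
    open ≤-Reasoning
    offsets-agree : offset r c s + t ≡ offset r c s' + t'
    offsets-agree =
      ≡ₘ⇒≡ (≤-<-trans (+-monoʳ-≤ _ t≤a) o+a<N) (≤-<-trans (+-monoʳ-≤ _ t'≤a') o'+a'<N)
           (≡ₘ-trans (≡ₘ-sym (offset-point r c s t x∈s)) (offset-point r c s' t' x∈s'))

  difference< : ∀ (s : Fin N) {x y : Fin N} {t t' a : ℕ} →
                toℕ x ≡ (toℕ s + t) % N → toℕ y ≡ (toℕ s + t') % N →
                1 ≤ t' → t' ≤ t → t ≤ a → a ≤ N → (toℕ x + N ∸ toℕ y) % N < a
  difference< s {x} {y} {t} {t'} {a} x≡s+t y≡s+t' 1≤t' t'≤t t≤a a≤N =
    subst (_< a) (sym (≡ₘ⇒≡ (m%n<n (toℕ x + N ∸ Y) N) (<-≤-trans d<a a≤N) difference≡ₘd)) d<a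
    where
    S = toℕ s
    Y = toℕ y
    w = N ∸ Y
    d = t ∸ t'
    d+t'≡t : d + t' ≡ t
    d+t'≡t = m∸n+n≡m t'≤t
    d<a : d < a
    d<a = <-≤-trans (m<m+n d 1≤t') (≤-trans (≤-reflexive d+t'≡t) t≤a)
    difference≡ₘd : (toℕ x + N ∸ Y) % N ≡ₘ d
    difference≡ₘd = begin
      (toℕ x + N ∸ Y) % N     ≈⟨ %-≡ₘ (toℕ x + N ∸ Y) ⟩
      toℕ x + N ∸ Y           ≡⟨ +-∸-assoc (toℕ x) (<⇒≤ (toℕ<n y)) ⟩
      toℕ x + w               ≡⟨ cong (_+ w) x≡s+t ⟩
      (S + t) % N + w         ≈⟨ +-congₘ (%-≡ₘ (S + t)) ≡ₘ-refl ⟩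
      S + t + w               ≡⟨ cong (λ u → S + u + w) d+t'≡t ⟨
      S + (d + t') + w        ≡⟨ cong (_+ w) (x∙yz≈y∙xz S d t') ⟩
      d + (S + t') + w        ≡⟨ +-assoc d (S + t') w ⟩
      d + (S + t' + w)        ≈⟨ +-congₘ (≡ₘ-refl {d}) (+-congₘ (%-≡ₘ (S + t')) (≡ₘ-refl {w})) ⟨
      d + ((S + t') % N + w)  ≡⟨ cong (λ u → d + (u + w)) y≡s+t' ⟨
      d + (Y + w)             ≡⟨ cong (d +_) (m+[n∸m]≡n (<⇒≤ (toℕ<n y))) ⟩
      d + N                   ≈⟨ +N-≡ₘ d ⟩
      d                       ∎
      where open ≡ₘ-Reasoning

  dist< : ∀ s {a} x y → InInterval N s a x → InInterval N s a y → a ≤ N → dist N x y < a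
  dist< s x y (t , (1≤t , t≤a) , x∈s) (t' , (1≤t' , t'≤a) , y∈s) a≤N with ≤-total t' t
  ... | inj₁ t'≤t = ≤-<-trans (m⊓n≤m _ _) (difference< s x∈s y∈s 1≤t' t'≤t t≤a a≤N)
  ... | inj₂ t≤t' = ≤-<-trans (m⊓n≤n _ _) (difference< s y∈s x∈s 1≤t t≤t' t'≤a a≤N)

module _ {A : Set} where

  unique-lookup-injective : ∀ {xs : List A} → Unique xs →
                            ∀ i j → lookup xs i ≡ lookup xs j → i ≡ j
  unique-lookup-injective (_ ∷ _) zero zero _ = refl
  unique-lookup-injective (x∉xs ∷ _) zero (suc j) eq =
    contradiction eq (All.lookup x∉xs (∈-lookup j))
  unique-lookup-injective (x∉xs ∷ _) (suc i) zero eq =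
    contradiction (sym eq) (All.lookup x∉xs (∈-lookup i))
  unique-lookup-injective (_ ∷ xs!) (suc i) (suc j) eq =
    cong suc (unique-lookup-injective xs! i j eq)

  injection⇒length≤ : ∀ {N} {xs : List A} → Unique xs → (code : ∀ {x} → x ∈ xs → Fin N) →
                      (∀ {x y} (x∈xs : x ∈ xs) (y∈xs : y ∈ xs) → code x∈xs ≡ code y∈xs → x ≡ y) →
                      length xs ≤ N
  injection⇒length≤ {N} {xs} xs! code code-injective with length xs ≤? N
  ... | yes xs≤N = xs≤N
  ... | no xs≰N =
    let i , j , i<j , same-code = pigeonhole (≰⇒> xs≰N) (code ∘ ∈-lookup)
    in contradiction (unique-lookup-injective xs! i j (code-injective _ _ same-code)) (Fin.<⇒≢ i<j)

  length≤filter+filter : ∀ {P : Pred A 0ℓ} (P? : Decidable P) xs →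
                         length xs ≤ length (filter P? xs) + length (filter (∁? P?) xs)
  length≤filter+filter P? [] = z≤n
  length≤filter+filter P? (x ∷ xs) with P? x
  ... | yes _ = s≤s (length≤filter+filter P? xs)
  ... | no _  = ≤-trans (s≤s (length≤filter+filter P? xs)) (≤-reflexive (sym (+-suc _ _)))

  []⊎minimal : (f : A → ℕ) (xs : List A) →
               xs ≡ [] ⊎ ∃[ m ] (m ∈ xs × ∀ {y} → y ∈ xs → f m ≤ f y)
  []⊎minimal f [] = inj₁ refl
  []⊎minimal f (x ∷ xs) =
    inj₂ (argmin f x xs , argmin-all f (here refl) (All.tabulate there) , minimal)
    where
    minimal : ∀ {y} → y ∈ x ∷ xs → f (argmin f x xs) ≤ f y
    minimal (here refl)  = f[argmin]≤f[⊤] {f = f} x xs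
    minimal (there y∈xs) = All.lookup (f[argmin]≤f[xs] {f = f} x xs) y∈xs

x∸1+y≤b+b : ∀ {b x y} → x ≤ b → y ≤ b → (x ∸ 1) + y ≤ b + b
x∸1+y≤b+b x≤b y≤b = +-mono-≤ (≤-trans (m∸n≤m _ 1) x≤b) y≤b

b+b+b≤4b : ∀ b → b + b + b ≤ 4 * b
b+b+b≤4b b = ≤-trans (m≤m+n (b + b + b) b) (≤-reflexive (b+b+b+b≡4b b))
  where
  b+b+b+b≡4b : ∀ b → b + b + b + b ≡ 4 * b
  b+b+b+b≡4b = solve-∀

[b+b]*[b+b]≡4[b*b] : ∀ b → (b + b) * (b + b) ≡ 4 * (b * b)
[b+b]*[b+b]≡4[b*b] = solve-∀

module FamilyMeetingBase
  {n₁ n₂ : ℕ} (k ℓ ℓ₀ : ℕ) (s₀ : Fin (suc n₂)) (L : List (Rect (suc n₁) (suc n₂)))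
  (K<N₁ : (k ∸ 1) + k < suc n₁)
  (P+ℓ≤N₂ : (ℓ ∸ 1) + ℓ₀ + ℓ ≤ suc n₂)
  (1≤ℓ : 1 ≤ ℓ)
  (L! : Unique L)
  (L-family : IsFamily k ℓ L)
  (L-proj-intersecting : ∀ {R R'} → R ∈ L → R' ∈ L → ProjIntersecting R R')
  (meets-base : ∀ {R} → R ∈ L → IntervalsMeet (suc n₂) s₀ ℓ₀ (s₂ R) (len₂ R))
  where

  N₁ N₂ K P : ℕ
  N₁ = suc n₁
  N₂ = suc n₂
  K = (k ∸ 1) + k
  P = (ℓ ∸ 1) + ℓ₀

  module C₁ = Cyclic n₁
  module C₂ = Cyclic n₂

  private
    Rc : Set
    Rc = Rect N₁ N₂

  shape : ∀ {R} → R ∈ L → R ≡ rect (s₁ R) k (s₂ R) ℓ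
  shape {R} r =
    cong₂ (λ a b → rect (s₁ R) a (s₂ R) b) (proj₁ (L-family R r)) (proj₂ (L-family R r))

  I-meet⊎J-meet : ∀ {R R'} → R ∈ L → R' ∈ L →
                  IntervalsMeet N₁ (s₁ R) k (s₁ R') k ⊎ IntervalsMeet N₂ (s₂ R) ℓ (s₂ R') ℓ
  I-meet⊎J-meet r r' = subst₂ ProjIntersecting (shape r) (shape r') (L-proj-intersecting r r')

  pos : Rc → ℕ
  pos R = C₂.offset s₀ (ℓ ∸ 1) (s₂ R)

  pos< : ∀ {R} → R ∈ L → pos R < P
  pos< {R} r = C₂.meet⇒offset< s₀ (s₂ R) J-meets-base (<-≤-trans (m<m+n P 1≤ℓ) P+ℓ≤N₂)
    where
    J-meets-base : IntervalsMeet N₂ s₀ ℓ₀ (s₂ R) ℓ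
    J-meets-base = subst (IntervalsMeet N₂ s₀ ℓ₀ (s₂ R)) (proj₂ (L-family R r)) (meets-base r)

  pos+ℓ<N₂ : ∀ {R} → R ∈ L → pos R + ℓ < N₂
  pos+ℓ<N₂ r = <-≤-trans (+-monoˡ-< ℓ (pos< r)) P+ℓ≤N₂

  s₁-pos-injective : ∀ {R R'} → R ∈ L → R' ∈ L → s₁ R ≡ s₁ R' → pos R ≡ pos R' → R ≡ R'
  s₁-pos-injective {R} {R'} r r' same-s₁ same-pos = begin
    R                         ≡⟨ shape r ⟩
    rect (s₁ R) k (s₂ R) ℓ    ≡⟨ cong₂ (λ u v → rect u k v ℓ) same-s₁ same-s₂ ⟩
    rect (s₁ R') k (s₂ R') ℓ  ≡⟨ shape r' ⟨
    R'                        ∎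
    where
    open ≡-Reasoning
    same-s₂ : s₂ R ≡ s₂ R'
    same-s₂ = C₂.offset-injective s₀ (ℓ ∸ 1) same-pos

  J-meet⇒pos< : ∀ {Q R} → Q ∈ L → R ∈ L → IntervalsMeet N₂ (s₂ Q) ℓ (s₂ R) ℓ → pos R < pos Q + ℓ
  J-meet⇒pos< {Q} {R} q r J-meet =
    C₂.meet⇒offset<offset+ s₀ (ℓ ∸ 1) (s₂ Q) (s₂ R) J-meet (pos+ℓ<N₂ q) (pos+ℓ<N₂ r)

  far⇒I-meet : ∀ {Q R} → Q ∈ L → R ∈ L → pos Q + ℓ ≤ pos R ⊎ pos R + ℓ ≤ pos Q →
               IntervalsMeet N₁ (s₁ Q) k (s₁ R) k
  far⇒I-meet q r far with I-meet⊎J-meet q r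
  ... | inj₁ I-meet = I-meet
  ... | inj₂ J-meet = contradiction far
    [ <⇒≱ (J-meet⇒pos< q r J-meet) , <⇒≱ (J-meet⇒pos< r q (map₂ swap J-meet)) ]

  I-offset : Rc → Rc → ℕ
  I-offset Q R = C₁.offset (s₁ Q) (k ∸ 1) (s₁ R)

  I-offset< : ∀ Q R → IntervalsMeet N₁ (s₁ Q) k (s₁ R) k → I-offset Q R < K
  I-offset< Q R I-meet = C₁.meet⇒offset< (s₁ Q) (s₁ R) I-meet K<N₁

  window-bound : ∀ {M} → Unique M → (∀ {R} → R ∈ M → R ∈ L) → ∀ lo w →
                 (∀ {R} → R ∈ M → lo ≤ pos R × pos R < lo + w) → length M ≤ w * N₁
  window-bound {M} M! M⊆L lo w in-window = injection⇒length≤ M! code code-injective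
    where
    index< : ∀ {R} → R ∈ M → pos R ∸ lo < w
    index< {R} r = subst (pos R ∸ lo <_) (m+n∸m≡n lo w)
                         (∸-monoˡ-< (proj₂ (in-window r)) (proj₁ (in-window r)))
    code : ∀ {R} → R ∈ M → Fin (w * N₁)
    code {R} r = combine (fromℕ< (index< r)) (s₁ R)
    code-injective : ∀ {R R'} (r : R ∈ M) (r' : R' ∈ M) → code r ≡ code r' → R ≡ R'
    code-injective r r' same-code =
      let same-index , same-s₁ = combine-injective _ _ _ _ same-code
      in s₁-pos-injective (M⊆L r) (M⊆L r') same-s₁
           (∸-cancelʳ-≡ (proj₁ (in-window r)) (proj₁ (in-window r'))
                        (fromℕ<-injective _ _ (index< r) (index< r') same-index))

  anchored-bound : ∀ {M Q Q'} → Unique M → (∀ {R} → R ∈ M → R ∈ L) → Q ∈ L → Q' ∈ L →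
                   (∀ {R} → R ∈ M → pos R + ℓ ≤ pos Q ⊎ pos Q' + ℓ ≤ pos R) →
                   length M ≤ P * K
  anchored-bound {M} {Q} {Q'} M! M⊆L q q' far = injection⇒length≤ M! code code-injective
    where
    -- The anchor depends on the position alone, so rectangles with equal codes share it.
    anchor : ℕ → Rc
    anchor p with p + ℓ ≤? pos Q
    ... | yes _ = Q
    ... | no _  = Q'
    anchor-I-meet : ∀ {R} → R ∈ M → IntervalsMeet N₁ (s₁ (anchor (pos R))) k (s₁ R) k
    anchor-I-meet {R} r with pos R + ℓ ≤? pos Q | far r
    ... | yes far-from-Q | _                = far⇒I-meet q (M⊆L r) (inj₂ far-from-Q)
    ... | no near-Q      | inj₁ far-from-Q  = contradiction far-from-Q near-Q
    ... | no _           | inj₂ far-from-Q' = far⇒I-meet q' (M⊆L r) (inj₁ far-from-Q')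
    I-offset<K : ∀ {R} → R ∈ M → I-offset (anchor (pos R)) R < K
    I-offset<K {R} r = I-offset< (anchor (pos R)) R (anchor-I-meet r)
    code : ∀ {R} → R ∈ M → Fin (P * K)
    code r = combine (fromℕ< (pos< (M⊆L r))) (fromℕ< (I-offset<K r))
    code-injective : ∀ {R R'} (r : R ∈ M) (r' : R' ∈ M) → code r ≡ code r' → R ≡ R'
    code-injective {R} {R'} r r' same-code =
      s₁-pos-injective (M⊆L r) (M⊆L r') same-s₁ same-pos
      where
      same-indices = combine-injective _ _ _ _ same-code
      same-pos : pos R ≡ pos R'
      same-pos = fromℕ<-injective _ _ (pos< (M⊆L r)) (pos< (M⊆L r')) (proj₁ same-indices)
      same-I-offset : I-offset (anchor (pos R')) R ≡ I-offset (anchor (pos R')) R'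
      same-I-offset = trans (cong (λ p → I-offset (anchor p) R) (sym same-pos))
        (fromℕ<-injective _ _ (I-offset<K r) (I-offset<K r') (proj₂ same-indices))
      same-s₁ = C₁.offset-injective (s₁ (anchor (pos R'))) (k ∸ 1) same-I-offset

  gap-bound : ∀ {Q Q'} → Q ∈ L → Q' ∈ L → pos Q + ℓ ≤ pos Q' →
              length L ≤ P * K + (ℓ ∸ 1) * N₁
  gap-bound {Q} {Q'} q q' gap = begin
    length L                                              ≤⟨ length≤filter+filter far? L ⟩
    length (filter far? L) + length (filter (∁? far?) L)  ≤⟨ +-mono-≤ far-bound middle-bound ⟩
    P * K + (ℓ ∸ 1) * N₁                                  ∎
    where
    open ≤-Reasoning
    Far : Pred Rc 0ℓ
    Far R = pos R + ℓ ≤ pos Q' ⊎ pos Q + ℓ ≤ pos R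
    far? : Decidable Far
    far? R = (pos R + ℓ ≤? pos Q') ⊎-dec (pos Q + ℓ ≤? pos R)
    far-bound : length (filter far? L) ≤ P * K
    far-bound = anchored-bound (filter⁺ far? L!) (proj₁ ∘ ∈-filter⁻ far? {xs = L}) q' q
                               (proj₂ ∘ ∈-filter⁻ far? {xs = L})
    in-middle : ∀ {R} → R ∈ filter (∁? far?) L →
                suc (pos Q) ≤ pos R × pos R < suc (pos Q) + (ℓ ∸ 1)
    in-middle {R} r with ∈-filter⁻ (∁? far?) {xs = L} r
    ... | _ , middle =
      +-cancelʳ-< ℓ (pos Q) (pos R) (≤-<-trans gap (≰⇒> (middle ∘ inj₁))) ,
      <-≤-trans (≰⇒> (middle ∘ inj₂)) (≤-reflexive (begin-equality
        pos Q + ℓ              ≡⟨ cong (pos Q +_) (m+[n∸m]≡n 1≤ℓ) ⟨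
        pos Q + (1 + (ℓ ∸ 1))  ≡⟨ +-suc (pos Q) (ℓ ∸ 1) ⟩
        suc (pos Q) + (ℓ ∸ 1)  ∎))
    middle-bound : length (filter (∁? far?) L) ≤ (ℓ ∸ 1) * N₁
    middle-bound = window-bound (filter⁺ (∁? far?) L!) (proj₁ ∘ ∈-filter⁻ (∁? far?) {xs = L})
                                (suc (pos Q)) (ℓ ∸ 1) in-middle

  length-bound : length L ≤ P * K + (ℓ ∸ 1) * N₁ ⊎ length L ≤ ℓ * N₁
  length-bound with []⊎minimal pos L
  ... | inj₁ L≡[] = inj₂ (subst (λ xs → length xs ≤ ℓ * N₁) (sym L≡[]) z≤n)
  ... | inj₂ (Q , q , minimal) with any? (λ R → pos Q + ℓ ≤? pos R) L
  ...   | yes ∃far = let Q' , q' , gap = find ∃far in inj₁ (gap-bound q q' gap)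
  ...   | no ∄far  =
    inj₂ (window-bound L! id (pos Q) ℓ (λ r → minimal r , ≰⇒> (∄far ∘ lose r)))

  length-bound-≤b : ∀ {b} → k ≤ b → ℓ ≤ b → ℓ₀ ≤ b →
                    length L ≤ 4 * (b * b) + (ℓ ∸ 1) * N₁ ⊎ length L ≤ ℓ * N₁
  length-bound-≤b {b} k≤b ℓ≤b ℓ₀≤b =
    map₁ (λ ≤PK+ → ≤-trans ≤PK+ (+-monoˡ-≤ ((ℓ ∸ 1) * N₁) PK≤4b²)) length-bound
    where
    PK≤4b² : P * K ≤ 4 * (b * b)
    PK≤4b² = ≤-trans (*-mono-≤ (x∸1+y≤b+b ℓ≤b ℓ₀≤b) (x∸1+y≤b+b k≤b k≤b))
                     (≤-reflexive ([b+b]*[b+b]≡4[b*b] b))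

blocking-pair⇒meets-base : ∀ {n₁ n₂ d} (R₁ R₂ R : Rect (suc n₁) (suc n₂)) →
  SameInterval (suc n₂) (s₂ R₁) (len₂ R₁) (s₂ R₂) (len₂ R₂) →
  IntervalDist≥ (suc n₁) (s₁ R₁) (len₁ R₁) (s₁ R₂) (len₁ R₂) d →
  len₁ R ≤ d → len₁ R ≤ suc n₁ → ProjIntersecting R R₁ → ProjIntersecting R R₂ →
  IntervalsMeet (suc n₂) (s₂ R₁) (len₂ R₁) (s₂ R) (len₂ R)
blocking-pair⇒meets-base _ _ _ _ _ _ _ (inj₂ J-meet₁) _ = map₂ swap J-meet₁
blocking-pair⇒meets-base _ _ _ same-J _ _ _ (inj₁ _) (inj₂ (z , z∈J , z∈J₂)) =
  z , Equivalence.from (same-J z) z∈J₂ , z∈J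
blocking-pair⇒meets-base {n₁} _ _ R _ apart len≤d len≤N₁
                         (inj₁ (x , x∈I , x∈I₁)) (inj₁ (y , y∈I , y∈I₂)) =
  contradiction (≤-trans len≤d (apart x y x∈I₁ y∈I₂))
                (<⇒≱ (Cyclic.dist< n₁ (s₁ R) x y x∈I y∈I len≤N₁))

lemma8 : (m : ℕ) (k ℓ : Fin (suc m) → ℕ) (b n₁ n₂ : ℕ)
    → 1 ≤ b
    → (∀ i → 1 ≤ k i × k i ≤ b)
    → (∀ i → 1 ≤ ℓ i × ℓ i ≤ b)
    → 4 * b < n₁ → 4 * b < n₂
    → (𝓡 : Fin (suc m) → List (Rect n₁ n₂))
    → (∀ i → Unique (𝓡 i))
    → (∀ i → IsFamily (k i) (ℓ i) (𝓡 i))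
    → UnionProjIntersecting 𝓡
    → HasBlockingPair b (𝓡 zero)
    → ∀ i → length (𝓡 i) < 9 * (b * b)
    ⊎ length (𝓡 i) ≤ 4 * (b * b) + (ℓ i ∸ 1) * n₁
    ⊎ length (𝓡 i) ≤ ℓ i * n₁
lemma8 m k ℓ b zero n₂ _ _ _ () _ _ _ _ _ _ _
lemma8 m k ℓ b (suc n₁) zero _ _ _ _ () _ _ _ _ _ _
lemma8 m k ℓ b (suc n₁) (suc n₂) _ k-bounds ℓ-bounds 4b<N₁ 4b<N₂ 𝓡 𝓡! 𝓡-family 𝓡-proj-intersecting
       (R₁ , R₂ , r₁ , r₂ , same-J , apart) i =
  inj₂ (length-bound-≤b kᵢ≤b ℓᵢ≤b ℓ₀≤b)
  where
  kᵢ≤b = proj₂ (k-bounds i)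
  ℓᵢ≤b = proj₂ (ℓ-bounds i)
  ℓ₀≤b : len₂ R₁ ≤ b
  ℓ₀≤b = subst (_≤ b) (sym (proj₂ (𝓡-family zero R₁ r₁))) (proj₂ (ℓ-bounds zero))
  K<N₁ : (k i ∸ 1) + k i < suc n₁
  K<N₁ = ≤-<-trans (≤-trans (x∸1+y≤b+b kᵢ≤b kᵢ≤b) (≤-trans (m≤m+n (b + b) b) (b+b+b≤4b b))) 4b<N₁
  P+ℓ≤N₂ : (ℓ i ∸ 1) + len₂ R₁ + ℓ i ≤ suc n₂
  P+ℓ≤N₂ = <⇒≤ (≤-<-trans (≤-trans (+-mono-≤ (x∸1+y≤b+b ℓᵢ≤b ℓ₀≤b) ℓᵢ≤b) (b+b+b≤4b b)) 4b<N₂)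
  meets-base : ∀ {R} → R ∈ 𝓡 i → IntervalsMeet (suc n₂) (s₂ R₁) (len₂ R₁) (s₂ R) (len₂ R)
  meets-base {R} r = blocking-pair⇒meets-base R₁ R₂ R same-J apart
    (≤-trans len≤b (n≤1+n b)) (≤-trans len≤b (≤-trans (m≤n*m b 4) (<⇒≤ 4b<N₁)))
    (𝓡-proj-intersecting i zero R R₁ r r₁) (𝓡-proj-intersecting i zero R R₂ r r₂)
    where
    len≤b : len₁ R ≤ b
    len≤b = subst (_≤ b) (sym (proj₁ (𝓡-family i R r))) kᵢ≤b
  open FamilyMeetingBase (k i) (ℓ i) (len₂ R₁) (s₂ R₁) (𝓡 i) K<N₁ P+ℓ≤N₂ (proj₁ (ℓ-bounds i))
                         (𝓡! i) (𝓡-family i) (𝓡-proj-intersecting i i _ _) meets-base
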